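{- Let $R$ be a p.q.-Baer $*$-ring such that $\Gamma^*_s(R)^c$ is connected. Then $\Gamma^*_s(R)^c$ is not complemented.
   Context: A $*$-ring is a ring $R$ with an involution $x\mapsto x^*$. A projection is an element $e$ with $e^2=e=e^*$. For $S\subseteq R$, $r_R(S)=\{x\in R: sx=0\ \forall s\in S\}$. $R$ is a p.q.-Baer $*$-ring if for every $a\in R$, $r_R(aR)=eR$ for some projection $e\in R$. The strong zero-divisor graph $\Gamma^*_s(R)$ is the simple undirected graph with vertex set $\{0\neq a\in R: r_R(aR)\neq\{0\}\}$, distinct vertices $a,b$ adjacent iff $aRb^*=0$. The complement $G^c$ of a simple graph $G$ has the same vertices, distinct vertices adjacent iff not adjacent in $G$. Distinct vertices $a,b$ are orthogonal if they are adjacent and have no common neighbour; a graph is complemented if every vertex has an orthogonal vertex. -}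

module Defs where

open import Level using (Level; _⊔_; suc)
open import Algebra.Bundles using (Ring)
open import Data.Product using (Σ; ∃; _×_; _,_; Σ-syntax; ∃-syntax)
open import Relation.Nullary using (¬_)
open import Relation.Binary.Construct.Closure.ReflexiveTransitive using (Star)

module GraphNotions {v ℓ e : Level} (V : Set v) (_≈ᵥ_ : V → V → Set ℓ)
                    (Adj : V → V → Set e) where

  Connected : Set (v ⊔ ℓ ⊔ e)
  Connected = V × ((u w : V) → ∃[ x ] (Star Adj u x × x ≈ᵥ w))

  Orthogonal : V → V → Set (v ⊔ e)
  Orthogonal a b = Adj a b × ¬ (∃[ c ] (Adj a c × Adj b c))

  Complemented : Set (v ⊔ e)
  Complemented = (a : V) → ∃[ b ] Orthogonal a b

  ComplAdj : V → V → Set (ℓ ⊔ e)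
  ComplAdj a b = ¬ (a ≈ᵥ b) × ¬ (Adj a b)

record StarRing (c ℓ : Level) : Set (suc (c ⊔ ℓ)) where
  field
    ring : Ring c ℓ
  open Ring ring public
  field
    _⋆      : Carrier → Carrier
    ⋆-cong  : ∀ {x y} → x ≈ y → (x ⋆) ≈ (y ⋆)
    ⋆-+     : ∀ x y → ((x + y) ⋆) ≈ ((x ⋆) + (y ⋆))
    ⋆-*     : ∀ x y → ((x * y) ⋆) ≈ ((y ⋆) * (x ⋆))
    ⋆-invol : ∀ x → ((x ⋆) ⋆) ≈ x

module StarRingNotions {c ℓ : Level} (R : StarRing c ℓ) where
  open StarRing R

  IsProjection : Carrier → Set ℓ
  IsProjection e = (e * e ≈ e) × ((e ⋆) ≈ e)

  InRAnn : Carrier → Carrier → Set (c ⊔ ℓ)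
  InRAnn a x = ∀ r → (a * r) * x ≈ 0#

  -- r_R(aR) = eR
  RAnnIsGenBy : Carrier → Carrier → Set (c ⊔ ℓ)
  RAnnIsGenBy a e = ∀ x → (InRAnn a x → ∃[ y ] (x ≈ e * y))
                        × ((∃[ y ] (x ≈ e * y)) → InRAnn a x)

  IsPQBaer : Set (c ⊔ ℓ)
  IsPQBaer = ∀ a → ∃[ e ] (IsProjection e × RAnnIsGenBy a e)

  IsVertex : Carrier → Set (c ⊔ ℓ)
  IsVertex a = ¬ (a ≈ 0#) × ∃[ x ] (¬ (x ≈ 0#) × InRAnn a x)

  Vertex : Set (c ⊔ ℓ)
  Vertex = Σ Carrier IsVertex

  _≈ᵥ_ : Vertex → Vertex → Set ℓ
  (a , _) ≈ᵥ (b , _) = a ≈ b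

  ΓAdj : Vertex → Vertex → Set (c ⊔ ℓ)
  ΓAdj (a , _) (b , _) = ¬ (a ≈ b) × (∀ r → (a * r) * (b ⋆) ≈ 0#)

  open GraphNotions Vertex _≈ᵥ_ ΓAdj public using (ComplAdj)

  module Γᶜ = GraphNotions Vertex _≈ᵥ_ ComplAdj

-- Let a, b be orthogonal in Γᶜ, with r(aR) = eR and r(bR) = fR. In a p.q.-Baer *-ring these
-- projections are central, and every vertex other than a and b is a Γ-neighbour of a or of b,
-- hence is killed by the central projection g = (1 - e)(1 - f), which is nonzero because a and b
-- are not Γ-adjacent. But g is itself a vertex with g·g = g ≠ 0, so g is a or b; say g = a.
-- If b = bg, the vertices fixed by g would be closed under Γᶜ-adjacency, contradicting
-- connectedness since e is not fixed. So b ≠ bg, whence e(1 - f) ≠ 0 lies in r((g + f)R), and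
-- g + f is a vertex other than a, b that g does not kill.
{-# OPTIONS --safe #-}
module Submission where

open import Level using (Level; _⊔_)
open import Data.Product using (∃-syntax; _×_; _,_; proj₁; proj₂)
open import Data.Empty using (⊥)
open import Data.Sum using (_⊎_; inj₁; inj₂)
open import Relation.Nullary using (¬_)
open import Relation.Nullary.Negation using (¬¬-map)
open import Relation.Binary.Construct.Closure.ReflexiveTransitive using (Star; ε; _◅_)
import Algebra.Properties.Ring as RingProperties
import Relation.Binary.Reasoning.Setoid as SetoidReasoning

open import Defs

module ConnectedGraph {v ℓ e : Level} {V : Set v}
                      (_≈ᵥ_ : V → V → Set ℓ) (Adj : V → V → Set e) where
  open GraphNotions V _≈ᵥ_ Adj

  walk-preserves : ∀ {p} (P : V → Set p) → (∀ {u w} → Adj u w → P u → P w) →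
                   ∀ {u w} → Star Adj u w → P u → P w
  walk-preserves P step ε         pu = pu
  walk-preserves P step (uv ◅ vw) pu = walk-preserves P step vw (step uv pu)

  connected-preserves : ∀ {p} → Connected → (P : V → Set p) →
                        (∀ {u w} → u ≈ᵥ w → P u → P w) →
                        (∀ {u w} → Adj u w → P u → P w) →
                        ∀ u w → P u → P w
  connected-preserves (_ , walk) P resp step u w pu with walk u w
  ... | x , u⋯x , x≈w = resp x≈w (walk-preserves P step u⋯x pu)

module StarRingProperties {c ℓ : Level} (R : StarRing c ℓ) where
  open StarRing R
  open StarRingNotions R
  open RingProperties ring
  open SetoidReasoning setoid

  ⋆-zero : (0# ⋆) ≈ 0#
  ⋆-zero = begin
    0# ⋆                ≈⟨ ⋆-cong (zeroˡ (0# ⋆)) ⟨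
    (0# * (0# ⋆)) ⋆     ≈⟨ ⋆-* 0# (0# ⋆) ⟩
    ((0# ⋆) ⋆) * (0# ⋆) ≈⟨ *-congʳ (⋆-invol 0#) ⟩
    0# * (0# ⋆)         ≈⟨ zeroˡ _ ⟩
    0#                  ∎

  ⋆-one : (1# ⋆) ≈ 1#
  ⋆-one = begin
    1# ⋆                    ≈⟨ *-identityʳ (1# ⋆) ⟨
    (1# ⋆) * 1#             ≈⟨ *-congˡ (⋆-invol 1#) ⟨
    (1# ⋆) * ((1# ⋆) ⋆)     ≈⟨ ⋆-* (1# ⋆) 1# ⟨
    ((1# ⋆) * 1#) ⋆         ≈⟨ ⋆-cong (*-identityʳ _) ⟩
    (1# ⋆) ⋆                ≈⟨ ⋆-invol 1# ⟩
    1#                      ∎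

  ⋆-neg : ∀ x → ((- x) ⋆) ≈ - (x ⋆)
  ⋆-neg x = +-inverseˡ-unique ((- x) ⋆) (x ⋆)
    (trans (sym (⋆-+ (- x) x)) (trans (⋆-cong (-‿inverseˡ x)) ⋆-zero))

  x⋆≈0⇒x≈0 : ∀ {x} → (x ⋆) ≈ 0# → x ≈ 0#
  x⋆≈0⇒x≈0 {x} x⋆≈0 = trans (sym (⋆-invol x)) (trans (⋆-cong x⋆≈0) ⋆-zero)

  inRAnn-flip : ∀ {x y} → InRAnn x y → InRAnn (y ⋆) (x ⋆)
  inRAnn-flip {x} {y} xRy≈0 r = begin
    ((y ⋆) * r) * (x ⋆)          ≈⟨ *-assoc (y ⋆) r (x ⋆) ⟩
    (y ⋆) * (r * (x ⋆))          ≈⟨ *-congˡ (*-congʳ (⋆-invol r)) ⟨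
    (y ⋆) * (((r ⋆) ⋆) * (x ⋆))  ≈⟨ *-congˡ (⋆-* x (r ⋆)) ⟨
    (y ⋆) * ((x * (r ⋆)) ⋆)      ≈⟨ ⋆-* (x * (r ⋆)) y ⟨
    ((x * (r ⋆)) * y) ⋆          ≈⟨ ⋆-cong (xRy≈0 (r ⋆)) ⟩
    0# ⋆                         ≈⟨ ⋆-zero ⟩
    0#                           ∎

  xp≈0⇒px⋆≈0 : ∀ {x p} → (p ⋆) ≈ p → x * p ≈ 0# → p * (x ⋆) ≈ 0#
  xp≈0⇒px⋆≈0 {x} {p} p⋆≈p xp≈0 = begin
    p * (x ⋆)        ≈⟨ *-congʳ p⋆≈p ⟨
    (p ⋆) * (x ⋆)    ≈⟨ ⋆-* x p ⟨
    (x * p) ⋆        ≈⟨ ⋆-cong xp≈0 ⟩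
    0# ⋆             ≈⟨ ⋆-zero ⟩
    0#               ∎

  inRAnn-+ : ∀ {x y z} → InRAnn x z → InRAnn y z → InRAnn (x + y) z
  inRAnn-+ {x} {y} {z} xRz≈0 yRz≈0 r = begin
    ((x + y) * r) * z           ≈⟨ *-congʳ (distribʳ r x y) ⟩
    (x * r + y * r) * z         ≈⟨ distribʳ z (x * r) (y * r) ⟩
    (x * r) * z + (y * r) * z   ≈⟨ +-cong (xRz≈0 r) (yRz≈0 r) ⟩
    0# + 0#                     ≈⟨ +-identityˡ 0# ⟩
    0#                          ∎

  x[1-p]≈x-xp : ∀ x p → x * (1# - p) ≈ x - x * p
  x[1-p]≈x-xp x p = trans (x[y-z]≈xy-xz x 1# p) (+-congʳ (*-identityʳ x))

  xp≈0⇒x[1-p]≈x : ∀ {x p} → x * p ≈ 0# → x * (1# - p) ≈ x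
  xp≈0⇒x[1-p]≈x {x} {p} xp≈0 = begin
    x * (1# - p)  ≈⟨ x[1-p]≈x-xp x p ⟩
    x - x * p     ≈⟨ +-congˡ (-‿cong xp≈0) ⟩
    x - 0#        ≈⟨ +-congˡ -0#≈0# ⟩
    x + 0#        ≈⟨ +-identityʳ x ⟩
    x             ∎

  x≈xp⇒x[1-p]≈0 : ∀ {x p} → x ≈ x * p → x * (1# - p) ≈ 0#
  x≈xp⇒x[1-p]≈0 {x} {p} x≈xp =
    trans (x[1-p]≈x-xp x p) (trans (+-congˡ (-‿cong (sym x≈xp))) (-‿inverseʳ x))

  x[1-p]≈0⇒x≈xp : ∀ {x p} → x * (1# - p) ≈ 0# → x ≈ x * p
  x[1-p]≈0⇒x≈xp {x} {p} x[1-p]≈0 = x∙y⁻¹≈ε⇒x≈y x (x * p) (trans (sym (x[1-p]≈x-xp x p)) x[1-p]≈0)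

  IsCentral : Carrier → Set (c ⊔ ℓ)
  IsCentral p = ∀ s → s * p ≈ p * s

  record IsCentralProjection (p : Carrier) : Set (c ⊔ ℓ) where
    field
      idem         : p * p ≈ p
      self-adjoint : (p ⋆) ≈ p
      central      : IsCentral p

  inRAnn-by-central : ∀ {p x z} → IsCentral p → x ≈ x * p → p * z ≈ 0# → InRAnn x z
  inRAnn-by-central {p} {x} {z} p-central x≈xp pz≈0 r = begin
    (x * r) * z        ≈⟨ *-congʳ (*-congʳ x≈xp) ⟩
    ((x * p) * r) * z  ≈⟨ *-congʳ (*-assoc x p r) ⟩
    (x * (p * r)) * z  ≈⟨ *-congʳ (*-congˡ (p-central r)) ⟨
    (x * (r * p)) * z  ≈⟨ *-assoc x (r * p) z ⟩
    x * ((r * p) * z)  ≈⟨ *-congˡ (*-assoc r p z) ⟩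
    x * (r * (p * z))  ≈⟨ *-congˡ (*-congˡ pz≈0) ⟩
    x * (r * 0#)       ≈⟨ *-congˡ (zeroʳ r) ⟩
    x * 0#             ≈⟨ zeroʳ x ⟩
    0#                 ∎

  1-p-isCentralProjection : ∀ {p} → IsCentralProjection p → IsCentralProjection (1# - p)
  1-p-isCentralProjection {p} p-cp = record
    { idem         = xp≈0⇒x[1-p]≈x [1-p]p≈0
    ; self-adjoint = trans (⋆-+ 1# (- p)) (+-cong ⋆-one (trans (⋆-neg p) (-‿cong self-adjoint)))
    ; central      = [1-p]-central
    }
    where
    open IsCentralProjection p-cp
    [1-p]p≈0 : (1# - p) * p ≈ 0#
    [1-p]p≈0 = begin
      (1# - p) * p    ≈⟨ [y-z]x≈yx-zx p 1# p ⟩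
      1# * p - p * p  ≈⟨ +-cong (*-identityˡ p) (-‿cong idem) ⟩
      p - p           ≈⟨ -‿inverseʳ p ⟩
      0#              ∎
    [1-p]-central : IsCentral (1# - p)
    [1-p]-central s = begin
      s * (1# - p)    ≈⟨ x[1-p]≈x-xp s p ⟩
      s - s * p       ≈⟨ +-cong (sym (*-identityˡ s)) (-‿cong (central s)) ⟩
      1# * s - p * s  ≈⟨ [y-z]x≈yx-zx s 1# p ⟨
      (1# - p) * s    ∎

  *-isCentralProjection : ∀ {p q} → IsCentralProjection p → IsCentralProjection q →
                          IsCentralProjection (p * q)
  *-isCentralProjection {p} {q} p-cp q-cp = record
    { idem         = pqpq≈pq
    ; self-adjoint = trans (⋆-* p q) (trans (*-cong Q.self-adjoint P.self-adjoint) (P.central q))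
    ; central      = pq-central
    }
    where
    module P = IsCentralProjection p-cp
    module Q = IsCentralProjection q-cp
    pqpq≈pq : (p * q) * (p * q) ≈ p * q
    pqpq≈pq = begin
      (p * q) * (p * q)  ≈⟨ *-assoc p q (p * q) ⟩
      p * (q * (p * q))  ≈⟨ *-congˡ (*-assoc q p q) ⟨
      p * ((q * p) * q)  ≈⟨ *-congˡ (*-congʳ (P.central q)) ⟩
      p * ((p * q) * q)  ≈⟨ *-congˡ (*-assoc p q q) ⟩
      p * (p * (q * q))  ≈⟨ *-assoc p p (q * q) ⟨
      (p * p) * (q * q)  ≈⟨ *-cong P.idem Q.idem ⟩
      p * q              ∎
    pq-central : IsCentral (p * q)
    pq-central s = begin
      s * (p * q)  ≈⟨ *-assoc s p q ⟨
      (s * p) * q  ≈⟨ *-congʳ (P.central s) ⟩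
      (p * s) * q  ≈⟨ *-assoc p s q ⟩
      p * (s * q)  ≈⟨ *-congˡ (Q.central s) ⟩
      p * (q * s)  ≈⟨ *-assoc p q s ⟨
      (p * q) * s  ∎

  module Generator (a : Carrier) (gen : ∃[ e ] (IsProjection e × RAnnIsGenBy a e)) where
    e : Carrier
    e = proj₁ gen

    private
      e-idem : e * e ≈ e
      e-idem = proj₁ (proj₁ (proj₂ gen))
      e-self-adjoint : (e ⋆) ≈ e
      e-self-adjoint = proj₂ (proj₁ (proj₂ gen))
      generates : RAnnIsGenBy a e
      generates = proj₂ (proj₂ gen)

    e∈rAnn : InRAnn a e
    e∈rAnn = proj₂ (generates e) (e , sym e-idem)

    ae≈0 : a * e ≈ 0#
    ae≈0 = trans (*-congʳ (sym (*-identityʳ a))) (e∈rAnn 1#)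

    inRAnn⇒x≈ex : ∀ {x} → InRAnn a x → x ≈ e * x
    inRAnn⇒x≈ex {x} x∈rAnn with proj₁ (generates x) x∈rAnn
    ... | t , x≈et = begin
      x            ≈⟨ x≈et ⟩
      e * t        ≈⟨ *-congʳ e-idem ⟨
      (e * e) * t  ≈⟨ *-assoc e e t ⟩
      e * (e * t)  ≈⟨ *-congˡ x≈et ⟨
      e * x        ∎

    -- aRs ⊆ aR puts se in r(aR) = eR, so ese = se; applying ⋆ to this for s⋆ gives es = ese.
    e-central : IsCentral e
    e-central s = sym (begin
      e * s                    ≈⟨ *-congʳ e-self-adjoint ⟨
      (e ⋆) * s                ≈⟨ *-congˡ (⋆-invol s) ⟨
      (e ⋆) * ((s ⋆) ⋆)        ≈⟨ ⋆-* (s ⋆) e ⟨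
      ((s ⋆) * e) ⋆            ≈⟨ ⋆-cong (ese≈se (s ⋆)) ⟨
      (e * ((s ⋆) * e)) ⋆      ≈⟨ ⋆-* e ((s ⋆) * e) ⟩
      (((s ⋆) * e) ⋆) * (e ⋆)  ≈⟨ *-cong (⋆-* (s ⋆) e) e-self-adjoint ⟩
      ((e ⋆) * ((s ⋆) ⋆)) * e  ≈⟨ *-congʳ (*-cong e-self-adjoint (⋆-invol s)) ⟩
      (e * s) * e              ≈⟨ *-assoc e s e ⟩
      e * (s * e)              ≈⟨ ese≈se s ⟩
      s * e                    ∎)
      where
      ese≈se : ∀ s → e * (s * e) ≈ s * e
      ese≈se s = sym (inRAnn⇒x≈ex λ r →
        trans (sym (*-assoc (a * r) s e)) (trans (*-congʳ (*-assoc a r s)) (e∈rAnn (r * s))))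

    e-isCentralProjection : IsCentralProjection e
    e-isCentralProjection = record
      { idem = e-idem ; self-adjoint = e-self-adjoint ; central = e-central }

    y≈ye⇒inRAnn-y⋆ : ∀ {y} → y ≈ y * e → InRAnn a (y ⋆)
    y≈ye⇒inRAnn-y⋆ {y} y≈ye = proj₂ (generates (y ⋆)) ((y ⋆) , (begin
      y ⋆              ≈⟨ ⋆-cong y≈ye ⟩
      (y * e) ⋆        ≈⟨ ⋆-* y e ⟩
      (e ⋆) * (y ⋆)    ≈⟨ *-congʳ e-self-adjoint ⟩
      e * (y ⋆)        ∎))

    inRAnn-y⋆⇒y≈ye : ∀ {y} → InRAnn a (y ⋆) → y ≈ y * e
    inRAnn-y⋆⇒y≈ye {y} y⋆∈rAnn = begin
      y                  ≈⟨ ⋆-invol y ⟨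
      (y ⋆) ⋆            ≈⟨ ⋆-cong (inRAnn⇒x≈ex y⋆∈rAnn) ⟩
      (e * (y ⋆)) ⋆      ≈⟨ ⋆-* e (y ⋆) ⟩
      ((y ⋆) ⋆) * (e ⋆)  ≈⟨ *-cong (⋆-invol y) e-self-adjoint ⟩
      y * e              ∎

    module _ (a-vertex : IsVertex a) where

      e≉0 : ¬ (e ≈ 0#)
      e≉0 e≈0 with proj₂ a-vertex
      ... | x , x≉0 , x∈rAnn =
        x≉0 (trans (inRAnn⇒x≈ex x∈rAnn) (trans (*-congʳ e≈0) (zeroˡ x)))

      e-isVertex : IsVertex e
      e-isVertex = e≉0 , (a ⋆) , (λ a⋆≈0 → proj₁ a-vertex (x⋆≈0⇒x≈0 a⋆≈0)) ,
        (λ r → trans (*-congʳ (*-congʳ (sym e-self-adjoint))) (inRAnn-flip e∈rAnn r))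

  ΓAdj-sym : ∀ {a b} → ΓAdj a b → ΓAdj b a
  ΓAdj-sym {a} {b} (a≉b , aRb⋆≈0) = (λ b≈a → a≉b (sym b≈a)) ,
    (λ r → trans (*-congʳ (*-congʳ (sym (⋆-invol (proj₁ b))))) (inRAnn-flip aRb⋆≈0 r))

  ComplAdj-sym : ∀ {a b} → ComplAdj a b → ComplAdj b a
  ComplAdj-sym {a} {b} (a≉b , ¬ab) = (λ b≈a → a≉b (sym b≈a)) , (λ ba → ¬ab (ΓAdj-sym {b} {a} ba))

  orthogonal-sym : ∀ {a b} → Γᶜ.Orthogonal a b → Γᶜ.Orthogonal b a
  orthogonal-sym {a} {b} (ab , no-common) =
    ComplAdj-sym {a} {b} ab , λ (y , by , ay) → no-common (y , ay , by)

  module OrthogonalPair (pqb : IsPQBaer) (a b : Vertex) (orth : Γᶜ.Orthogonal a b) where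
    A B : Carrier
    A = proj₁ a
    B = proj₁ b

    module Eᵃ = Generator A (pqb A)
    module Eᵇ = Generator B (pqb B)
    open Eᵃ using (e)
    open Eᵇ renaming (e to f) using ()
    open IsCentralProjection Eᵃ.e-isCentralProjection renaming (idem to e-idem) using ()
    open IsCentralProjection Eᵇ.e-isCentralProjection
      renaming (idem to f-idem; central to f-central) using ()
    open IsCentralProjection (1-p-isCentralProjection Eᵃ.e-isCentralProjection)
      renaming (central to [1-e]-central) using ()
    open IsCentralProjection (1-p-isCentralProjection Eᵇ.e-isCentralProjection)
      renaming (central to [1-f]-central) using ()

    g : Carrier
    g = (1# - e) * (1# - f)

    g-isCentralProjection : IsCentralProjection g
    g-isCentralProjection = *-isCentralProjection
      (1-p-isCentralProjection Eᵃ.e-isCentralProjection)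
      (1-p-isCentralProjection Eᵇ.e-isCentralProjection)

    open IsCentralProjection g-isCentralProjection renaming
      (idem to g-idem; self-adjoint to g-self-adjoint; central to g-central) using ()

    g≈[1-f][1-e] : g ≈ (1# - f) * (1# - e)
    g≈[1-f][1-e] = sym ([1-e]-central (1# - f))

    y≈ye⇒yg≈0 : ∀ {y} → y ≈ y * e → y * g ≈ 0#
    y≈ye⇒yg≈0 {y} y≈ye = begin
      y * g                      ≈⟨ *-assoc y (1# - e) (1# - f) ⟨
      (y * (1# - e)) * (1# - f)  ≈⟨ *-congʳ (x≈xp⇒x[1-p]≈0 y≈ye) ⟩
      0# * (1# - f)              ≈⟨ zeroˡ _ ⟩
      0#                         ∎

    y≈yf⇒yg≈0 : ∀ {y} → y ≈ y * f → y * g ≈ 0#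
    y≈yf⇒yg≈0 {y} y≈yf = begin
      y * g                      ≈⟨ *-congˡ g≈[1-f][1-e] ⟩
      y * ((1# - f) * (1# - e))  ≈⟨ *-assoc y (1# - f) (1# - e) ⟨
      (y * (1# - f)) * (1# - e)  ≈⟨ *-congʳ (x≈xp⇒x[1-p]≈0 y≈yf) ⟩
      0# * (1# - e)              ≈⟨ zeroˡ _ ⟩
      0#                         ∎

    eg≈0 : e * g ≈ 0#
    eg≈0 = y≈ye⇒yg≈0 (sym e-idem)

    ge≈0 : g * e ≈ 0#
    ge≈0 = trans (sym (g-central e)) eg≈0

    gf≈0 : g * f ≈ 0#
    gf≈0 = trans (sym (g-central f)) (y≈yf⇒yg≈0 (sym f-idem))

    g-kills-others : (y : Vertex) → ¬ (proj₁ y ≈ A) → ¬ (proj₁ y ≈ B) → ¬ ¬ (proj₁ y * g ≈ 0#)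
    g-kills-others y y≉A y≉B yg≉0 = proj₂ orth (y ,
      ((λ A≈y → y≉A (sym A≈y)) , λ (_ , A⊥y) → yg≉0 (y≈ye⇒yg≈0 (Eᵃ.inRAnn-y⋆⇒y≈ye A⊥y))) ,
      ((λ B≈y → y≉B (sym B≈y)) , λ (_ , B⊥y) → yg≉0 (y≈yf⇒yg≈0 (Eᵇ.inRAnn-y⋆⇒y≈ye B⊥y))))

    g≉0 : ¬ (g ≈ 0#)
    g≉0 g≈0 = proj₂ (proj₁ orth) (proj₁ (proj₁ orth) , Eᵃ.y≈ye⇒inRAnn-y⋆ (x[1-p]≈0⇒x≈xp (begin
      B * (1# - e)               ≈⟨ *-congʳ (xp≈0⇒x[1-p]≈x Eᵇ.ae≈0) ⟨
      (B * (1# - f)) * (1# - e)  ≈⟨ *-assoc B (1# - f) (1# - e) ⟩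
      B * ((1# - f) * (1# - e))  ≈⟨ *-congˡ g≈[1-f][1-e] ⟨
      B * g                      ≈⟨ *-congˡ g≈0 ⟩
      B * 0#                     ≈⟨ zeroʳ B ⟩
      0#                         ∎)))

    g≈A⊎g≈B : ¬ ¬ (g ≈ A ⊎ g ≈ B)
    g≈A⊎g≈B ¬g≈A⊎g≈B = g-kills-others
      (g , g≉0 , e , Eᵃ.e≉0 (proj₂ a) , inRAnn-by-central g-central (sym g-idem) ge≈0)
      (λ g≈A → ¬g≈A⊎g≈B (inj₁ g≈A)) (λ g≈B → ¬g≈A⊎g≈B (inj₂ g≈B))
      (λ gg≈0 → g≉0 (trans (sym g-idem) gg≈0))

    module _ (conn : Γᶜ.Connected) (g≈A : g ≈ A) where

      A≈Ag : A ≈ A * g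
      A≈Ag = trans (sym g≈A) (trans (sym g-idem) (*-congʳ g≈A))

      B≉Bg : ¬ (B ≈ B * g)
      -- The vertices are passed explicitly: _≈ᵥ_ and ΓAdj compute, so they cannot be inferred.
      B≉Bg B≈Bg = connected-preserves conn FixedByG
        (λ {y} {w} → respects {y} {w}) (λ {y} {w} → step {y} {w})
        a (e , Eᵃ.e-isVertex (proj₂ a)) (λ A≉Ag → A≉Ag A≈Ag)
        (λ e≈eg → Eᵃ.e≉0 (proj₂ a) (trans e≈eg eg≈0))
        where
        open ConnectedGraph _≈ᵥ_ ComplAdj using (connected-preserves)
        FixedByG : Vertex → Set ℓ
        FixedByG y = ¬ ¬ (proj₁ y ≈ proj₁ y * g)
        fixed-cong : ∀ {x y} → x ≈ y → y ≈ y * g → x ≈ x * g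
        fixed-cong x≈y y≈yg = trans x≈y (trans y≈yg (*-congʳ (sym x≈y)))
        respects : ∀ {y w} → y ≈ᵥ w → FixedByG y → FixedByG w
        respects y≈w = ¬¬-map (fixed-cong (sym y≈w))
        step : ∀ {y w} → ComplAdj y w → FixedByG y → FixedByG w
        step {y} {w} (y≉w , ¬y⊥w) y-fixed w-unfixed = g-kills-others w
          (λ w≈A → w-unfixed (fixed-cong w≈A A≈Ag))
          (λ w≈B → w-unfixed (fixed-cong w≈B B≈Bg))
          (λ wg≈0 → y-fixed λ y≈yg →
            ¬y⊥w (y≉w , inRAnn-by-central g-central y≈yg (xp≈0⇒px⋆≈0 g-self-adjoint wg≈0)))

      Be≉0 : ¬ (B * e ≈ 0#)
      Be≉0 Be≈0 = B≉Bg (sym (begin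
        B * g                      ≈⟨ *-assoc B (1# - e) (1# - f) ⟨
        (B * (1# - e)) * (1# - f)  ≈⟨ *-congʳ (xp≈0⇒x[1-p]≈x Be≈0) ⟩
        B * (1# - f)               ≈⟨ xp≈0⇒x[1-p]≈x Eᵇ.ae≈0 ⟩
        B                          ∎))

      z : Carrier
      z = e * (1# - f)

      z≉0 : ¬ (z ≈ 0#)
      z≉0 z≈0 = Be≉0 (begin
        B * e                ≈⟨ *-congʳ (xp≈0⇒x[1-p]≈x Eᵇ.ae≈0) ⟨
        (B * (1# - f)) * e   ≈⟨ *-assoc B (1# - f) e ⟩
        B * ((1# - f) * e)   ≈⟨ *-congˡ ([1-f]-central e) ⟨
        B * z                ≈⟨ *-congˡ z≈0 ⟩
        B * 0#               ≈⟨ zeroʳ B ⟩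
        0#                   ∎)

      x : Carrier
      x = g + f

      xg≈g : x * g ≈ g
      xg≈g = trans (distribʳ g g f) (trans (+-cong g-idem (y≈yf⇒yg≈0 (sym f-idem))) (+-identityʳ g))

      xf≈f : x * f ≈ f
      xf≈f = trans (distribʳ f g f) (trans (+-cong gf≈0 f-idem) (+-identityˡ f))

      x-isVertex : IsVertex x
      x-isVertex = (λ x≈0 → g≉0 (trans (sym xg≈g) (trans (*-congʳ x≈0) (zeroˡ g)))) ,
        z , z≉0 , inRAnn-+ (inRAnn-by-central g-central (sym g-idem) gz≈0)
                           (inRAnn-by-central f-central (sym f-idem) fz≈0)
        where
        gz≈0 : g * z ≈ 0#
        gz≈0 = trans (sym (*-assoc g e (1# - f))) (trans (*-congʳ ge≈0) (zeroˡ _))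
        fz≈0 : f * z ≈ 0#
        fz≈0 = begin
          f * (e * (1# - f))  ≈⟨ *-congˡ ([1-f]-central e) ⟩
          f * ((1# - f) * e)  ≈⟨ *-assoc f (1# - f) e ⟨
          (f * (1# - f)) * e  ≈⟨ *-congʳ (x≈xp⇒x[1-p]≈0 (sym f-idem)) ⟩
          0# * e              ≈⟨ zeroˡ e ⟩
          0#                  ∎

      g≈A⇒⊥ : ⊥
      g≈A⇒⊥ = g-kills-others (x , x-isVertex)
        (λ x≈A → Eᵇ.e≉0 (proj₂ b) (trans (sym xf≈f) (trans (*-congʳ (trans x≈A (sym g≈A))) gf≈0)))
        (λ x≈B → Eᵇ.e≉0 (proj₂ b) (trans (sym xf≈f) (trans (*-congʳ x≈B) Eᵇ.ae≈0)))
        (λ xg≈0 → g≉0 (trans (sym xg≈g) xg≈0))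

  no-orthogonal-pair : IsPQBaer → Γᶜ.Connected → ∀ a b → ¬ Γᶜ.Orthogonal a b
  no-orthogonal-pair pqb conn a b orth = g≈A⊎g≈B λ where
      (inj₁ g≈A) → g≈A⇒⊥ conn g≈A
      (inj₂ g≈B) → BA.g≈A⇒⊥ conn (trans (sym g≈[1-f][1-e]) g≈B)
    where
    open OrthogonalPair pqb a b orth
    module BA = OrthogonalPair pqb b a (orthogonal-sym {a} {b} orth)

lemma4p13 : ∀ {c ℓ} (R : StarRing c ℓ) →
    StarRingNotions.IsPQBaer R →
    StarRingNotions.Γᶜ.Connected R →
    ¬ StarRingNotions.Γᶜ.Complemented R
lemma4p13 R pqb conn@(a , _) complemented =
  let b , orth = complemented a in
  StarRingProperties.no-orthogonal-pair R pqb conn a b orth
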